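{- During a delete-min operation in a smooth heap or slim heap, a root wins at most one left link and at most one right link. Hence during a delete-min each node acquires at most one new left child and at most one new right child.
   Context: A smooth or slim heap is a forest of heap-ordered rooted ordered trees whose roots form a list (ordered left to right). Key comparisons use the strict total order $\prec$: $a \prec b$ iff $\mathrm{key}(a)<\mathrm{key}(b)$, or the keys are equal and $a$ lies to the right of $b$ in the list. A link of two nodes adjacent in the root list makes the $\prec$-smaller one (the winner) the parent of the other (the loser), removing the loser from the root list; it is a left link if the loser was left of the winner and a right link if the loser was right of the winner; the loser becomes a left child or right child of the winner accordingly. A delete-min removes the min-root, replaces it in the root list by its children (in their order), and then performs leftmost locally maximum linking until one root remains: repeatedly, let $v$ be the leftmost root that is $\prec$-larger than each of its existing neighbours in the root list, and link $v$ with whichever of its existing neighbours is $\prec$-larger. (In a slim heap the loser becomes the leftmost child of the winner; in a smooth heap it becomes the leftmost child after a left link and the rightmost child after a right link; the statement concerns only which links are won.) -}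

module Defs where

open import Level using (Level; _⊔_)
open import Data.Nat as ℕ using (ℕ; zero; suc)
open import Data.Nat.Properties using () renaming (_<?_ to _<ℕ?_)
open import Data.Bool using (Bool; true; false)
open import Data.List using (List; []; _∷_; length; filter; _++_)
open import Data.List.Relation.Unary.All using (All)
open import Data.Maybe using (Maybe; just; nothing)
open import Data.Product using (_×_; _,_; proj₁; proj₂)
open import Data.Sum using (_⊎_; inj₁; inj₂; [_,_])
open import Data.Unit.Polymorphic using (⊤)
open import Relation.Nullary using (Dec; yes; no; ¬_)
open import Relation.Nullary.Decidable using (_×-dec_)
open import Relation.Binary.PropositionalEquality using (_≡_; refl)
open import Relation.Binary using (StrictTotalOrder; tri<; tri≈; tri>)

-- Direction of a link: 'left' = the loser was left of the winner
-- (the loser becomes a left child); 'right' = the loser was right of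
-- the winner (the loser becomes a right child).
data Dir : Set where
  left right : Dir

_≟Dir_ : (d e : Dir) → Dec (d ≡ e)
left  ≟Dir left  = yes refl
left  ≟Dir right = no (λ ())
right ≟Dir left  = no (λ ())
right ≟Dir right = yes refl

module Heap {a ℓ₁ ℓ₂} (O : StrictTotalOrder a ℓ₁ ℓ₂) where
  open StrictTotalOrder O renaming (Carrier to Key)

  data Tree : Set a where
    node : Key → List Tree → Tree

  rootKey : Tree → Key
  rootKey (node k _) = k

  mutual
    HeapOrdered : Tree → Set ℓ₂
    HeapOrdered (node k cs) = ChildrenOrdered k cs

    ChildrenOrdered : Key → List Tree → Set ℓ₂
    ChildrenOrdered k []       = ⊤
    ChildrenOrdered k (c ∷ cs) = (¬ (rootKey c < k)) × HeapOrdered c × ChildrenOrdered k cs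

  -- A root of the root list: its position in the root list (positions
  -- are 0,1,2,... from left to right) and its key.  Linking never
  -- changes the relative left-to-right order of the remaining roots,
  -- so the original positions decide "lies to the right of".
  record Root : Set a where
    constructor mkRoot
    field
      pos : ℕ
      key : Key
  open Root public

  _≺_ : Root → Root → Set (ℓ₁ ⊔ ℓ₂)
  x ≺ y = (key x < key y) ⊎ ((key x ≈ key y) × (pos y ℕ.< pos x))

  _≺?_ : (x y : Root) → Dec (x ≺ y)
  x ≺? y with compare (key x) (key y)
  ... | tri< p _ _ = yes (inj₁ p)
  ... | tri≈ ¬p q _ with pos y <ℕ? pos x
  ...   | yes r = yes (inj₂ (q , r))
  ...   | no ¬r = no [ ¬p , (λ z → ¬r (proj₂ z)) ]
  x ≺? y | tri> ¬p ¬q _ = no [ ¬p , (λ z → ¬q (proj₁ z)) ]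

  roots : ℕ → List Tree → List Root
  roots i []       = []
  roots i (t ∷ ts) = mkRoot i (rootKey t) ∷ roots (suc i) ts

  record Link : Set a where
    constructor mkLink
    field
      winner : Root
      loser  : Root
      dir    : Dir
  open Link public

  -- One step of leftmost locally maximum linking.
  -- lm ml x rs : x is a root, ml its left neighbour (if any), rs the
  -- roots to the right of x; all roots left of ml were already found
  -- not to be locally maximal.  Returns the link performed and the
  -- new root list from x's position onwards.
  lm : Maybe Root → Root → List Root → Maybe (Link × List Root)
  lm nothing  x []       = nothing
  lm (just p) x [] with p ≺? x
  ... | yes _ = just (mkLink p x right , [])
  ... | no  _ = nothing
  lm nothing  x (y ∷ rs) with y ≺? x
  ... | yes _ = just (mkLink y x left , y ∷ rs)
  ... | no  _ with lm (just x) y rs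
  ...   | nothing        = nothing
  ...   | just (l , suf) = just (l , x ∷ suf)
  lm (just p) x (y ∷ rs) with p ≺? x | y ≺? x
  ... | yes _ | yes _ with y ≺? p
  ...   | yes _ = just (mkLink p x right , y ∷ rs)
  ...   | no  _ = just (mkLink y x left  , y ∷ rs)
  lm (just p) x (y ∷ rs) | _ | _ with lm (just x) y rs
  ...   | nothing        = nothing
  ...   | just (l , suf) = just (l , x ∷ suf)

  step : List Root → Maybe (Link × List Root)
  step []       = nothing
  step (x ∷ rs) = lm nothing x rs

  -- repeat linking until one root remains (each step removes a root,
  -- so 'length' steps of fuel always suffice); returns the links in order
  linkAll : ℕ → List Root → List Link
  linkAll zero    rs = []
  linkAll (suc f) rs with step rs
  ... | nothing        = []
  ... | just (l , rs′) = l ∷ linkAll f rs′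

  -- the links performed by a delete-min whose root list, after the
  -- min-root has been replaced by its children, is ts
  deleteMinLinks : List Tree → List Link
  deleteMinLinks ts = linkAll (length ts) (roots 0 ts)

  -- number of links of direction d won by the root at position p
  -- (= number of new d-children the node at position p acquires)
  wins : ℕ → Dir → List Link → ℕ
  wins p d ls = length (filter (λ l → (pos (winner l) ℕ.≟ p) ×-dec (dir l ≟Dir d)) ls)

  IsMinRoot : ℕ → Key → List Tree → Set (a ⊔ ℓ₁ ⊔ ℓ₂)
  IsMinRoot i k ts = All (λ r → (pos r ≡ i) ⊎ (mkRoot i k ≺ r)) (roots 0 ts)

-- The bound does not depend on heap order or on which root was minimal: it holds for
-- leftmost locally maximum linking on any root list.  Suppose the root at position p
-- wins a left link.  Its loser was the leftmost locally maximal root, so the root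
-- left of the loser (if any) is not ≺-larger than it, hence ≺-smaller than p; and if
-- p wins a right link, the loser chose the ≺-larger of its neighbours, so its other
-- neighbour, now right of p, is ≺-smaller than p.  A root whose neighbour on one side
-- is ≺-smaller cannot win a link from that side, because a loser must be ≺-larger
-- than both of its neighbours; for the same reason that neighbour is never removed,
-- so this shield persists until p itself loses.
module Submission where

open import Defs
open import Data.Nat using (ℕ; zero; suc; _≤_; _<_; z≤n; _≟_)
open import Data.List using (List; _∷_; _++_; length)
open import Data.List.Relation.Unary.All using (All)
open import Data.Product using (_×_; _,_)
open import Relation.Binary using (StrictTotalOrder; tri<; tri≈; tri>)
open import Level using (_⊔_)
open import Data.Nat.Properties using (<-irrefl; <-asym; <-trans; <⇒≤; ≤-<-trans; <-≤-trans; ≤-refl; ≤-reflexive; >⇒≢)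
open import Data.List using ([]; head)
open import Data.List.Properties using (filter-accept; filter-reject)
open import Data.Maybe using (Maybe; just; nothing)
open import Data.Maybe.Relation.Unary.All as Maybe using (just; nothing)
open import Data.Sum using (inj₁; inj₂)
open import Data.Unit.Polymorphic using (⊤; tt)
open import Data.Empty using (⊥-elim)
open import Relation.Nullary using (Dec; yes; no; ¬_)
open import Relation.Nullary.Decidable using (_×-dec_)
open import Relation.Binary.PropositionalEquality using (_≡_; _≢_; refl; sym; trans; cong; subst)

module DeleteMinLinking {a ℓ₁ ℓ₂} (O : StrictTotalOrder a ℓ₁ ℓ₂) where
  open Heap O
  open StrictTotalOrder O using (compare; irrefl; asym)
  module Key = StrictTotalOrder.Eq O

  ≺-asym : ∀ {x y} → x ≺ y → ¬ y ≺ x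
  ≺-asym (inj₁ x<y)       (inj₁ y<x)       = asym x<y y<x
  ≺-asym (inj₁ x<y)       (inj₂ (y≈x , _)) = irrefl (Key.sym y≈x) x<y
  ≺-asym (inj₂ (x≈y , _)) (inj₁ y<x)       = irrefl (Key.sym x≈y) y<x
  ≺-asym (inj₂ (_ , y<x)) (inj₂ (_ , x<y)) = <-asym y<x x<y

  ⊀⇒≺ : ∀ {x y} → pos x < pos y → ¬ y ≺ x → x ≺ y
  ⊀⇒≺ {x} {y} x<y y⊀x with compare (key x) (key y)
  ... | tri< kx<ky _ _ = inj₁ kx<ky
  ... | tri≈ _ kx≈ky _ = ⊥-elim (y⊀x (inj₂ (Key.sym kx≈ky , x<y)))
  ... | tri> _ _ ky<kx = ⊥-elim (y⊀x (inj₁ ky<kx))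

  OnOutcome : ∀ {ℓ} → (Link → List Root → Set ℓ) → Maybe (Link × List Root) → Set (a ⊔ ℓ)
  OnOutcome P = Maybe.All (λ (l , s) → P l s)

  -- The Maybe argument is the left neighbour of the list, nothing at the left end.
  _<ᵖ_ : Maybe Root → ℕ → Set
  nothing <ᵖ i = ⊤
  just u  <ᵖ i = pos u < i

  Ascending : Maybe Root → List Root → Set
  Ascending m []       = ⊤
  Ascending m (x ∷ xs) = m <ᵖ pos x × Ascending (just x) xs

  roots-ascending : ∀ {m} i ts → m <ᵖ i → Ascending m (roots i ts)
  roots-ascending i []       _   = tt
  roots-ascending i (t ∷ ts) m<i = m<i , roots-ascending (suc i) ts ≤-refl

  lm-ascending : ∀ m x rs → Ascending m (x ∷ rs) → OnOutcome (λ _ s → Ascending m s) (lm m x rs)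
  lm-ascending nothing  x []       _ = nothing
  lm-ascending (just u) x []       _ with u ≺? x
  ... | yes _ = just tt
  ... | no  _ = nothing
  lm-ascending nothing  x (y ∷ rs) (_ , x<y , asc) with y ≺? x
  ... | yes _ = just (tt , asc)
  ... | no  _ with lm (just x) y rs | lm-ascending (just x) y rs (x<y , asc)
  ...   | nothing        | _         = nothing
  ...   | just _         | just asc′ = just (tt , asc′)
  lm-ascending (just u) x (y ∷ rs) (u<x , x<y , asc) with u ≺? x | y ≺? x
  ... | yes _ | yes _ with y ≺? u
  ...   | yes _ = just (<-trans u<x x<y , asc)
  ...   | no  _ = just (<-trans u<x x<y , asc)
  lm-ascending (just u) x (y ∷ rs) (u<x , x<y , asc) | yes _ | no _
    with lm (just x) y rs | lm-ascending (just x) y rs (x<y , asc)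
  ...   | nothing        | _         = nothing
  ...   | just _         | just asc′ = just (u<x , asc′)
  lm-ascending (just u) x (y ∷ rs) (u<x , x<y , asc) | no _ | _
    with lm (just x) y rs | lm-ascending (just x) y rs (x<y , asc)
  ...   | nothing        | _         = nothing
  ...   | just _         | just asc′ = just (u<x , asc′)

  lm-winner-position : ∀ u x rs → Ascending (just u) (x ∷ rs) →
    OnOutcome (λ l _ → pos u ≤ pos (winner l) × (dir l ≡ left → pos u < pos (winner l)))
              (lm (just u) x rs)
  lm-winner-position u x []       _ with u ≺? x
  ... | yes _ = just (≤-refl , λ ())
  ... | no  _ = nothing
  lm-winner-position u x (y ∷ rs) (u<x , x<y , asc) with u ≺? x | y ≺? x
  ... | yes _ | yes _ with y ≺? u
  ...   | yes _ = just (≤-refl , λ ())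
  ...   | no  _ = just (<⇒≤ u<y , λ _ → u<y)
    where
      u<y : pos u < pos y
      u<y = <-trans u<x x<y
  lm-winner-position u x (y ∷ rs) (u<x , x<y , asc) | yes _ | no _
    with lm (just x) y rs | lm-winner-position x y rs (x<y , asc)
  ...   | nothing | _                = nothing
  ...   | just _  | just (x≤w , _) = just (<⇒≤ (<-≤-trans u<x x≤w) , λ _ → <-≤-trans u<x x≤w)
  lm-winner-position u x (y ∷ rs) (u<x , x<y , asc) | no _ | _
    with lm (just x) y rs | lm-winner-position x y rs (x<y , asc)
  ...   | nothing | _                = nothing
  ...   | just _  | just (x≤w , _) = just (<⇒≤ (<-≤-trans u<x x≤w) , λ _ → <-≤-trans u<x x≤w)

  step-ascending : ∀ rs → Ascending nothing rs → OnOutcome (λ _ s → Ascending nothing s) (step rs)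
  step-ascending []       _   = nothing
  step-ascending (x ∷ rs) asc = lm-ascending nothing x rs asc

  module Shielding (p : ℕ) (d : Dir) where
    Wins : Link → Set
    Wins l = pos (winner l) ≡ p × dir l ≡ d

    wins? : (l : Link) → Dec (Wins l)
    wins? l = (pos (winner l) ≟ p) ×-dec (dir l ≟Dir d)

    _≺ᵐ_ : Maybe Root → Root → Set (ℓ₁ ⊔ ℓ₂)
    nothing ≺ᵐ x = ⊤
    just u  ≺ᵐ x = u ≺ x

    LeftShielded : Maybe Root → Root → Set (ℓ₁ ⊔ ℓ₂)
    LeftShielded m x = d ≡ left → pos x ≡ p → m ≺ᵐ x

    RightShielded : Maybe Root → Maybe Root → Set (ℓ₁ ⊔ ℓ₂)
    RightShielded nothing  r = ⊤
    RightShielded (just x) r = d ≡ right → pos x ≡ p → r ≺ᵐ x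

    Shielded : Maybe Root → List Root → Set (ℓ₁ ⊔ ℓ₂)
    Shielded m []       = RightShielded m nothing
    Shielded m (x ∷ xs) = RightShielded m (just x) × LeftShielded m x × Shielded (just x) xs

    shielded-beyond : ∀ u xs → p ≤ pos u → Ascending (just u) xs →
                      RightShielded (just u) (head xs) → Shielded (just u) xs
    shielded-beyond u []       _   _           rs-u = rs-u
    shielded-beyond u (x ∷ xs) p≤u (u<x , asc) rs-u =
      rs-u , (λ _ x≡p → ⊥-elim (x≢p x≡p)) ,
      shielded-beyond x xs (<⇒≤ p<x) asc (λ _ x≡p → ⊥-elim (x≢p x≡p))
      where
        p<x : p < pos x
        p<x = ≤-<-trans p≤u u<x
        x≢p : pos x ≢ p
        x≢p = >⇒≢ p<x

    lm-preserves-shield : ∀ m x rs → Shielded m (x ∷ rs) →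
                          OnOutcome (λ l s → ¬ Wins l × Shielded m s) (lm m x rs)
    lm-preserves-shield nothing  x []       _ = nothing
    lm-preserves-shield (just u) x []       (rs-u , _) with u ≺? x
    ... | yes u≺x = just ((λ { (u≡p , refl) → ≺-asym u≺x (rs-u refl u≡p) }) , λ _ _ → tt)
    ... | no  _   = nothing
    lm-preserves-shield nothing  x (y ∷ rs) (_ , ls-x , rs-x , ls-y , sh) with y ≺? x
    ... | yes y≺x = just ((λ { (y≡p , refl) → ≺-asym y≺x (ls-y refl y≡p) }) , tt , (λ _ _ → tt) , sh)
    ... | no  _ with lm (just x) y rs | lm-preserves-shield (just x) y rs (rs-x , ls-y , sh)
    ...   | nothing | _                = nothing
    ...   | just _  | just (¬win , sh′) = just (¬win , tt , ls-x , sh′)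
    lm-preserves-shield (just u) x (y ∷ rs) (rs-u , ls-x , rs-x , ls-y , sh) with u ≺? x | y ≺? x
    ... | yes u≺x | yes y≺x with y ≺? u
    ...   | yes y≺u = just ((λ { (u≡p , refl) → ≺-asym u≺x (rs-u refl u≡p) }) ,
                            (λ _ _ → y≺u) , (λ dl y≡p → ⊥-elim (≺-asym y≺x (ls-y dl y≡p))) , sh)
    ...   | no  _   = just ((λ { (y≡p , refl) → ≺-asym y≺x (ls-y refl y≡p) }) ,
                            (λ dr u≡p → ⊥-elim (≺-asym u≺x (rs-u dr u≡p))) ,
                            (λ dl y≡p → ⊥-elim (≺-asym y≺x (ls-y dl y≡p))) , sh)
    lm-preserves-shield (just u) x (y ∷ rs) (rs-u , ls-x , rs-x , ls-y , sh) | yes _ | no _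
      with lm (just x) y rs | lm-preserves-shield (just x) y rs (rs-x , ls-y , sh)
    ...   | nothing | _                = nothing
    ...   | just _  | just (¬win , sh′) = just (¬win , rs-u , ls-x , sh′)
    lm-preserves-shield (just u) x (y ∷ rs) (rs-u , ls-x , rs-x , ls-y , sh) | no _ | _
      with lm (just x) y rs | lm-preserves-shield (just x) y rs (rs-x , ls-y , sh)
    ...   | nothing | _                = nothing
    ...   | just _  | just (¬win , sh′) = just (¬win , rs-u , ls-x , sh′)

    shielded-left-of-winner : ∀ {u x l s} → pos u < pos x → pos x ≤ pos (winner l) →
                              (dir l ≡ left → pos x < pos (winner l)) →
                              (Wins l → Shielded (just x) s) → Wins l → Shielded (just u) (x ∷ s)
    shielded-left-of-winner u<x x≤w left⇒x<w win⇒sh win@(w≡p , dir≡d) =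
      (λ _ u≡p → ⊥-elim (<-irrefl (trans u≡p (sym w≡p)) (<-≤-trans u<x x≤w))) ,
      (λ d≡left x≡p → ⊥-elim (<-irrefl (trans x≡p (sym w≡p)) (left⇒x<w (trans dir≡d d≡left)))) ,
      win⇒sh win

    lm-win-shields : ∀ m x rs → Ascending m (x ∷ rs) →
                     OnOutcome (λ l s → Wins l → Shielded m s) (lm m x rs)
    lm-win-shields nothing  x []       _ = nothing
    lm-win-shields (just u) x []       _ with u ≺? x
    ... | yes _ = just (λ _ _ _ → tt)
    ... | no  _ = nothing
    lm-win-shields nothing  x (y ∷ rs) (_ , x<y , asc) with y ≺? x
    ... | yes _ = just λ { (y≡p , refl) →
                    tt , (λ _ _ → tt) , shielded-beyond y rs (≤-reflexive (sym y≡p)) asc (λ ()) }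
    ... | no  _ with lm (just x) y rs | lm-win-shields (just x) y rs (x<y , asc)
    ...   | nothing | _             = nothing
    ...   | just _  | just win⇒sh = just λ win → tt , (λ _ _ → tt) , win⇒sh win
    lm-win-shields (just u) x (y ∷ rs) (u<x , x<y , asc) with u ≺? x | y ≺? x
    ... | yes _ | yes _ with y ≺? u
    ...   | yes y≺u = just λ { (u≡p , refl) →
                        (λ _ _ → y≺u) , (λ ()) ,
                        shielded-beyond y rs (<⇒≤ (p<y u≡p)) asc (λ _ y≡p → ⊥-elim (>⇒≢ (p<y u≡p) y≡p)) }
      where
        p<y : pos u ≡ p → p < pos y
        p<y refl = <-trans u<x x<y
    ...   | no y⊀u  = just λ { (y≡p , refl) →
                        (λ ()) , (λ _ _ → ⊀⇒≺ (<-trans u<x x<y) y⊀u) ,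
                        shielded-beyond y rs (≤-reflexive (sym y≡p)) asc (λ ()) }
    lm-win-shields (just u) x (y ∷ rs) (u<x , x<y , asc) | yes _ | no _
      with lm (just x) y rs | lm-win-shields (just x) y rs (x<y , asc)
         | lm-winner-position x y rs (x<y , asc)
    ...   | nothing        | _             | _                       = nothing
    ...   | just (l , suf) | just win⇒sh | just (x≤w , left⇒x<w) =
            just (shielded-left-of-winner {l = l} {s = suf} u<x x≤w left⇒x<w win⇒sh)
    lm-win-shields (just u) x (y ∷ rs) (u<x , x<y , asc) | no _ | _
      with lm (just x) y rs | lm-win-shields (just x) y rs (x<y , asc)
         | lm-winner-position x y rs (x<y , asc)
    ...   | nothing        | _             | _                       = nothing
    ...   | just (l , suf) | just win⇒sh | just (x≤w , left⇒x<w) =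
            just (shielded-left-of-winner {l = l} {s = suf} u<x x≤w left⇒x<w win⇒sh)

    step-preserves-shield : ∀ rs → Shielded nothing rs →
                            OnOutcome (λ l s → ¬ Wins l × Shielded nothing s) (step rs)
    step-preserves-shield []       _  = nothing
    step-preserves-shield (x ∷ rs) sh = lm-preserves-shield nothing x rs sh

    step-win-shields : ∀ rs → Ascending nothing rs →
                       OnOutcome (λ l s → Wins l → Shielded nothing s) (step rs)
    step-win-shields []       _   = nothing
    step-win-shields (x ∷ rs) asc = lm-win-shields nothing x rs asc

    wins-∷-reject : ∀ {l} ls → ¬ Wins l → wins p d (l ∷ ls) ≡ wins p d ls
    wins-∷-reject ls ¬win = cong length (filter-reject wins? {xs = ls} ¬win)

    wins-∷-accept : ∀ {l} ls → Wins l → wins p d (l ∷ ls) ≡ suc (wins p d ls)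
    wins-∷-accept ls win = cong length (filter-accept wins? {xs = ls} win)

    shielded⇒wins≡0 : ∀ fuel rs → Shielded nothing rs → wins p d (linkAll fuel rs) ≡ 0
    shielded⇒wins≡0 zero       rs _  = refl
    shielded⇒wins≡0 (suc fuel) rs sh with step rs | step-preserves-shield rs sh
    ... | nothing      | _                 = refl
    ... | just (l , s) | just (¬win , sh′) =
          trans (wins-∷-reject (linkAll fuel s) ¬win) (shielded⇒wins≡0 fuel s sh′)

    wins≤1 : ∀ fuel rs → Ascending nothing rs → wins p d (linkAll fuel rs) ≤ 1
    wins≤1 zero       rs _   = z≤n
    wins≤1 (suc fuel) rs asc with step rs | step-ascending rs asc | step-win-shields rs asc
    ... | nothing      | _         | _             = z≤n
    ... | just (l , s) | just asc′ | just win⇒sh with wins? l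
    ...   | yes win  = ≤-reflexive (trans (wins-∷-accept (linkAll fuel s) win)
                                          (cong suc (shielded⇒wins≡0 fuel s (win⇒sh win))))
    ...   | no  ¬win = subst (_≤ 1) (sym (wins-∷-reject (linkAll fuel s) ¬win)) (wins≤1 fuel s asc′)

lemma1 : ∀ {a ℓ₁ ℓ₂} (O : StrictTotalOrder a ℓ₁ ℓ₂) →
         let open Heap O in
         (pre : List Tree) (k : StrictTotalOrder.Carrier O) (cs post : List Tree) →
         All HeapOrdered (pre ++ node k cs ∷ post) →
         IsMinRoot (length pre) k (pre ++ node k cs ∷ post) →
         (p : ℕ) →
         (wins p left (deleteMinLinks (pre ++ cs ++ post)) ≤ 1)
         × (wins p right (deleteMinLinks (pre ++ cs ++ post)) ≤ 1)
lemma1 O pre k cs post _ _ p = wins-after-delete-min≤1 left , wins-after-delete-min≤1 right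
  where
    open Heap O using (Tree; roots; wins; deleteMinLinks)
    open DeleteMinLinking O
    ts : List Tree
    ts = pre ++ cs ++ post
    wins-after-delete-min≤1 : ∀ d → wins p d (deleteMinLinks ts) ≤ 1
    wins-after-delete-min≤1 d = Shielding.wins≤1 p d (length ts) (roots 0 ts) (roots-ascending 0 ts tt)
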